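{- Let $H_2^*$ be the hypergraph with vertex set $\{1,2,3,\dots\}$ whose edges are all nonempty finite subsets of $\{1,2,3,\dots\}$, and let $H_2$ be the hypergraph obtained by replacing each edge $e$ of $H_2^*$ by the gadget $G_e$ (so the vertex set of $H_2$ is $\{1,2,\dots\}$ together with all new vertices of all gadgets, and $E(H_2)=\bigcup_{e\in E(H_2^*)}E(G_e)$). Suppose $C$ is a strongly minimal edge-cover of $H_2$. Then for every edge $e$ of $H_2^*$, with $k=|e|$, the set $C\cap E(G_e)$ either has exactly $k$ elements, or is exactly the set of the $k-1$ inner edges of $G_e$.
   Context: An edge-cover is a set of edges whose union is the whole vertex set; an edge-cover $C$ is strongly minimal if every edge-cover $C'$ satisfies $|C\setminus C'|\leq|C'\setminus C|$. Gadget: for an edge $e$ with $k=|e|\geq 2$, fix a labelling $e=\{v_1,\dots,v_k\}$ and add $2k-2$ new vertices $v_i^+$ ($1\le i\le k-1$) and $v_i^-$ ($2\le i\le k$), new vertices of different gadgets being distinct and distinct from original vertices. $G_e$ has vertex set $e$ together with these new vertices and edges: the inner edges $\{v_i^+,v_{i+1}^-\}$ for $1\le i\le k-1$, and the outer edges $\{v_1,v_1^+\}$, $\{v_k,v_k^-\}$ and $\{v_i,v_i^-,v_i^+\}$ for $2\le i\le k-1$. For $k=1$ we take $G_e$ to consist of the single edge $e$, which is its unique outer edge (no inner edges). -}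

module Defs where

open import Data.Nat using (ℕ; zero; suc; _+_)
open import Data.Fin using (Fin; toℕ)
open import Data.List using (List; []; _∷_; length)
open import Data.List.NonEmpty using (List⁺; _∷_; tail)
open import Data.Vec using (Vec; lookup) renaming ([] to []ᵥ; _∷_ to _∷ᵥ_)
open import Data.Product using (Σ; Σ-syntax; _×_; _,_; proj₁)
open import Data.Sum using (_⊎_)
open import Relation.Nullary using (¬_)
open import Relation.Binary.PropositionalEquality using (_≡_)

-- Original vertices are the natural numbers (relabelling {1,2,3,...} as
-- {0,1,2,...} via n ↦ n-1).  An edge of H₂* is a nonempty finite subset
-- of ℕ, encoded canonically by a nonempty list of gaps
--   d₀ ∷ d₁ ∷ ... ∷ d_{k-1}
-- standing for the set {v₁ < v₂ < ... < v_k} with v₁ = d₀ and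
-- v_{i+1} = v_i + 1 + d_i.  This is a bijection between List⁺ ℕ and
-- nonempty finite subsets of ℕ.

E* : Set
E* = List⁺ ℕ

m : E* → ℕ
m e = length (tail e)

-- The fixed labelling v₁ < ... < v_k of e (increasing order);
-- lookup (elems e) i is v_{i+1}.
elems : (e : E*) → Vec ℕ (suc (m e))
elems (d ∷ ds) = go d ds
  where
  go : ℕ → (ds : List ℕ) → Vec ℕ (suc (length ds))
  go acc []       = acc ∷ᵥ []ᵥ
  go acc (d ∷ ds) = acc ∷ᵥ go (acc + suc d) ds

-- Vertices of H₂: original vertices, and for each edge e of H₂* (with
-- k = |e|) the new vertices
--   plus  e i  = v_{i+1}^+   for i : Fin (k-1)   (1 ≤ i+1 ≤ k-1)
--   minus e i  = v_{i+2}^-   for i : Fin (k-1)   (2 ≤ i+2 ≤ k)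
-- New vertices of different gadgets are distinct and distinct from the
-- original ones, since they are distinct constructors / indices.

data V : Set where
  orig  : ℕ → V
  plus  : (e : E*) → Fin (m e) → V
  minus : (e : E*) → Fin (m e) → V

-- Edges of the gadget G_e:
--   inner i  = {v_{i+1}^+ , v_{i+2}^-}          for i : Fin (k-1)
--   outer j  = outer edge containing v_{j+1}    for j : Fin k
data GEdge (e : E*) : Set where
  inner : Fin (m e) → GEdge e
  outer : Fin (suc (m e)) → GEdge e

Edge : Set
Edge = Σ E* GEdge

IsInner : {e : E*} → GEdge e → Set
IsInner {e} g = Σ (Fin (m e)) (λ i → g ≡ inner i)

-- Vertex membership in the edges of H₂.
-- outer j = {v_{j+1}} ∪ {v_{j+1}^+ if j+1 ≤ k-1} ∪ {v_{j+1}^- if j+1 ≥ 2},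
-- which gives {v₁,v₁^+}, {v_k,v_k^-}, {v_i,v_i^-,v_i^+} (2≤i≤k-1) for
-- k ≥ 2, and the single edge e = {v₁} for k = 1.
_∈ₑ_ : V → Edge → Set
v ∈ₑ (e , inner i) = (v ≡ plus e i) ⊎ (v ≡ minus e i)
v ∈ₑ (e , outer j) =
  (v ≡ orig (lookup (elems e) j))
  ⊎ (Σ (Fin (m e)) λ i → (toℕ i ≡ toℕ j) × (v ≡ plus e i))
  ⊎ (Σ (Fin (m e)) λ i → (suc (toℕ i) ≡ toℕ j) × (v ≡ minus e i))

EdgeSet : Set₁
EdgeSet = Edge → Set

IsEdgeCover : EdgeSet → Set
IsEdgeCover C = (v : V) → Σ Edge (λ f → C f × (v ∈ₑ f))

_∖_ : EdgeSet → EdgeSet → EdgeSet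
(A ∖ B) f = A f × ¬ B f

_≤card_ : {X : Set} → (X → Set) → (X → Set) → Set
_≤card_ {X} A B =
  Σ (Σ X A → Σ X B) λ φ →
    (x y : Σ X A) → proj₁ (φ x) ≡ proj₁ (φ y) → proj₁ x ≡ proj₁ y

IsStronglyMinimal : EdgeSet → Set₁
IsStronglyMinimal C =
  IsEdgeCover C × ((C' : EdgeSet) → IsEdgeCover C' → (C ∖ C') ≤card (C' ∖ C))

HasSize : {X : Set} → (X → Set) → ℕ → Set
HasSize {X} P n =
  Σ (Fin n → Σ X P) λ φ →
    ((i j : Fin n) → proj₁ (φ i) ≡ proj₁ (φ j) → i ≡ j)
    × ((x : X) → P x → Σ (Fin n) λ i → proj₁ (φ i) ≡ x)

_∩G_ : EdgeSet → (e : E*) → GEdge e → Set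
(C ∩G e) g = C (e , g)

-- The k outer and k − 1 inner edges of G_e alternate along a path in which
-- consecutive edges share a new vertex lying in no other edge.  So if a
-- outer and b inner edges of G_e are in C, C has no two consecutive gaps
-- along that path: a + b ≥ k − 1, with equality only for "all inner, no
-- outer".  Conversely, replacing C ∩ E(G_e) by all k outer edges gives
-- another cover, and strong minimality injects the removed inner edges
-- into the added outer ones: b ≤ k − a.  These counts exist constructively
-- because a strongly minimal cover is decidable: each of its edges is the
-- edge chosen to cover one of its own finitely many vertices, since
-- otherwise dropping it would leave a smaller cover.
module Submission where

open import Defs
open import Data.Nat using (ℕ; zero; suc; _+_; _≤_; _≟_; z≤n; s≤s)
open import Data.Nat.Properties
  using (+-suc; +-monoʳ-≤; n≤1+n; ≤-trans; ≤-reflexive; ≤-antisym; <-irrefl; m≤n⇒m<n∨m≡n)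
  renaming (suc-injective to ℕ-suc-injective)
open import Data.Fin using (Fin; zero; suc; inject₁; splitAt; join)
open import Data.Fin.Properties
  using (suc-injective; toℕ-injective; toℕ-inject₁; splitAt-join; join-splitAt; injective⇒≤)
  renaming (_≟_ to _≟ᶠ_)
open import Data.List using (List; []; _∷_; map; _++_; allFin)
open import Data.List.NonEmpty using (_∷_; head; tail)
open import Data.List.Properties using (≡-dec)
open import Data.List.Relation.Unary.Any using (here; there; any?; satisfied)
open import Data.List.Membership.Propositional using (_∈_; lose)
open import Data.List.Membership.Propositional.Properties using (∈-map⁺; ∈-++⁺ˡ; ∈-++⁺ʳ; ∈-allFin)
open import Data.Vec using (lookup)
open import Data.Product using (Σ; _×_; _,_; proj₁; proj₂; uncurry; <_,_>)
import Data.Product as Σ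
import Data.Product.Properties as Σ
open import Data.Sum using (_⊎_; inj₁; inj₂)
import Data.Sum as ⊎
open import Data.Empty using (⊥-elim)
open import Function using (_∘_; id)
open import Level using (0ℓ)
open import Relation.Nullary using (¬_; yes; no; ¬?)
open import Relation.Nullary.Decidable using (map′; _×-dec_)
open import Relation.Unary using (Pred; Decidable)
open import Relation.Binary.Definitions using (DecidableEquality)
open import Relation.Binary.PropositionalEquality
  using (_≡_; _≢_; refl; sym; trans; cong; cong₂; subst; module ≡-Reasoning)

count : ∀ {n} {P : Pred (Fin n) 0ℓ} → Decidable P → ℕ
count {zero}  P? = 0
count {suc n} P? with P? zero
... | yes _ = suc (count (P? ∘ suc))
... | no  _ = count (P? ∘ suc)

enumerate : ∀ {n} {P : Pred (Fin n) 0ℓ} (P? : Decidable P) → HasSize P (count P?)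
enumerate {zero}  P? = (λ ()) , (λ ()) , (λ ())
enumerate {suc n} {P} P? with P? zero | enumerate (P? ∘ suc)
... | yes p | φ , φ-inj , φ-surj = χ , χ-inj , χ-surj
  where
  χ : Fin (suc (count (P? ∘ suc))) → Σ (Fin (suc n)) P
  χ zero    = zero , p
  χ (suc k) = Σ.map suc id (φ k)

  χ-inj : ∀ k l → proj₁ (χ k) ≡ proj₁ (χ l) → k ≡ l
  χ-inj zero    zero    _  = refl
  χ-inj (suc k) (suc l) eq = cong suc (φ-inj k l (suc-injective eq))

  χ-surj : ∀ x → P x → Σ (Fin _) λ k → proj₁ (χ k) ≡ x
  χ-surj zero    _  = zero , refl
  χ-surj (suc x) px = Σ.map suc (cong suc) (φ-surj x px)
... | no ¬p | φ , φ-inj , φ-surj =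
  Σ.map suc id ∘ φ , (λ k l → φ-inj k l ∘ suc-injective) , χ-surj
  where
  χ-surj : ∀ x → P x → Σ (Fin _) λ k → suc (proj₁ (φ k)) ≡ x
  χ-surj zero    px = ⊥-elim (¬p px)
  χ-surj (suc x) px = Σ.map id (cong suc) (φ-surj x px)

count-∁ : ∀ {n} {P : Pred (Fin n) 0ℓ} (P? : Decidable P) → count P? + count (¬? ∘ P?) ≡ n
count-∁ {zero}  P? = refl
count-∁ {suc n} P? with P? zero
... | yes _ = cong suc (count-∁ (P? ∘ suc))
... | no  _ = trans (+-suc _ _) (cong suc (count-∁ (P? ∘ suc)))

HasSize-mono : ∀ {X Y : Set} {P : Pred X 0ℓ} {Q : Pred Y 0ℓ} {a b : ℕ} →
  HasSize P a → HasSize Q b → (f : Σ X P → Σ Y Q) →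
  (∀ x y → proj₁ (f x) ≡ proj₁ (f y) → proj₁ x ≡ proj₁ y) → a ≤ b
HasSize-mono (φ , φ-inj , _) (ψ , _ , ψ-surj) f f-inj = injective⇒≤ h-inj
  where
  h : Fin _ → Fin _
  h = proj₁ ∘ uncurry ψ-surj ∘ f ∘ φ

  h-inj : ∀ {k l} → h k ≡ h l → k ≡ l
  h-inj {k} {l} eq = φ-inj k l (f-inj (φ k) (φ l) (begin
    proj₁ (f (φ k))   ≡⟨ sym (proj₂ (uncurry ψ-surj (f (φ k)))) ⟩
    proj₁ (ψ (h k))   ≡⟨ cong (proj₁ ∘ ψ) eq ⟩
    proj₁ (ψ (h l))   ≡⟨ proj₂ (uncurry ψ-surj (f (φ l))) ⟩
    proj₁ (f (φ l))   ∎))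
    where open ≡-Reasoning

-- The sequence A₀ B₀ A₁ B₁ … Bₙ₋₁ Aₙ has no two consecutive gaps.
record NoTwoGaps {n} (A : Pred (Fin (suc n)) 0ℓ) (B : Pred (Fin n) 0ℓ) : Set where
  field
    A-or-B : ∀ i → A (inject₁ i) ⊎ B i
    B-or-A : ∀ i → B i ⊎ A (suc i)
open NoTwoGaps

NoTwoGaps-tail : ∀ {n} {A : Pred (Fin (suc (suc n))) 0ℓ} {B : Pred (Fin (suc n)) 0ℓ} →
  NoTwoGaps A B → NoTwoGaps (A ∘ suc) (B ∘ suc)
NoTwoGaps-tail gaps = record { A-or-B = A-or-B gaps ∘ suc ; B-or-A = B-or-A gaps ∘ suc }

NoTwoGaps-count-≥ : ∀ {n} {A : Pred (Fin (suc n)) 0ℓ} {B : Pred (Fin n) 0ℓ}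
  (A? : Decidable A) (B? : Decidable B) → NoTwoGaps A B → n ≤ count A? + count B?
NoTwoGaps-count-≥ {zero}  A? B? _ = z≤n
NoTwoGaps-count-≥ {suc n} A? B? gaps with A? zero | B? zero
  | NoTwoGaps-count-≥ (A? ∘ suc) (B? ∘ suc) (NoTwoGaps-tail gaps)
... | yes _ | yes _ | ih = s≤s (≤-trans ih (+-monoʳ-≤ _ (n≤1+n _)))
... | yes _ | no _  | ih = s≤s ih
... | no _  | yes _ | ih = subst (suc n ≤_) (sym (+-suc _ _)) (s≤s ih)
... | no ¬a | no ¬b | _ with A-or-B gaps zero
...   | inj₁ a = ⊥-elim (¬a a)
...   | inj₂ b = ⊥-elim (¬b b)

NoTwoGaps-count-tight : ∀ {n} {A : Pred (Fin (suc n)) 0ℓ} {B : Pred (Fin n) 0ℓ}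
  (A? : Decidable A) (B? : Decidable B) → NoTwoGaps A B →
  count A? + count B? ≡ n → (∀ i → B i) × (∀ j → ¬ A j)
NoTwoGaps-count-tight {zero} A? B? _ tight with A? zero
NoTwoGaps-count-tight {zero} A? B? _ () | yes _
... | no ¬a = (λ ()) , λ { zero → ¬a }
NoTwoGaps-count-tight {suc n} A? B? gaps tight with A? zero | B? zero
... | yes _ | yes _ =
  ⊥-elim (<-irrefl refl (≤-trans (≤-reflexive (trans (sym (+-suc _ _)) (ℕ-suc-injective tight)))
                                 (NoTwoGaps-count-≥ (A? ∘ suc) (B? ∘ suc) (NoTwoGaps-tail gaps))))
... | yes _ | no ¬b
  with NoTwoGaps-count-tight (A? ∘ suc) (B? ∘ suc) (NoTwoGaps-tail gaps) (ℕ-suc-injective tight)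
     | B-or-A gaps zero
...   | _ , no-A | inj₂ a = ⊥-elim (no-A zero a)
...   | _ , _    | inj₁ b = ⊥-elim (¬b b)
NoTwoGaps-count-tight {suc n} A? B? gaps tight | no ¬a | yes b
  with NoTwoGaps-count-tight (A? ∘ suc) (B? ∘ suc) (NoTwoGaps-tail gaps)
         (ℕ-suc-injective (trans (sym (+-suc _ _)) tight))
...   | all-B , no-A = (λ { zero → b ; (suc i) → all-B i }) , λ { zero → ¬a ; (suc j) → no-A j }
NoTwoGaps-count-tight {suc n} A? B? gaps tight | no ¬a | no ¬b with A-or-B gaps zero
...   | inj₁ a = ⊥-elim (¬a a)
...   | inj₂ b = ⊥-elim (¬b b)

outer-injective : ∀ {e} {j j' : Fin (suc (m e))} → outer {e} j ≡ outer j' → j ≡ j'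
outer-injective refl = refl

inner-injective : ∀ {e} {i i' : Fin (m e)} → inner {e} i ≡ inner i' → i ≡ i'
inner-injective refl = refl

_≟E*_ : DecidableEquality E*
e ≟E* e' = map′ (uncurry (cong₂ _∷_)) < cong head , cong tail >
                (head e ≟ head e' ×-dec ≡-dec _≟_ (tail e) (tail e'))

_≟G_ : ∀ {e} → DecidableEquality (GEdge e)
inner i ≟G inner i' = map′ (cong inner) inner-injective (i ≟ᶠ i')
outer j ≟G outer j' = map′ (cong outer) outer-injective (j ≟ᶠ j')
inner _ ≟G outer _  = no λ ()
outer _ ≟G inner _  = no λ ()

_≟Edge_ : DecidableEquality Edge
_≟Edge_ = Σ.≡-dec _≟E*_ _≟G_

HasSize-gadget : ∀ {e} {P : Pred (GEdge e) 0ℓ} {a b} →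
  HasSize (P ∘ outer) a → HasSize (P ∘ inner) b → HasSize P (a + b)
HasSize-gadget {e} {P} {a} {b} (φ , φ-inj , φ-surj) (ψ , ψ-inj , ψ-surj) =
  χ ∘ splitAt a , χ∘splitAt-inj , χ-surj
  where
  χ : Fin a ⊎ Fin b → Σ (GEdge e) P
  χ (inj₁ k) = Σ.map outer id (φ k)
  χ (inj₂ k) = Σ.map inner id (ψ k)

  χ-inj : ∀ s t → proj₁ (χ s) ≡ proj₁ (χ t) → s ≡ t
  χ-inj (inj₁ k) (inj₁ l) eq = cong inj₁ (φ-inj k l (outer-injective eq))
  χ-inj (inj₂ k) (inj₂ l) eq = cong inj₂ (ψ-inj k l (inner-injective eq))

  χ∘splitAt-inj : ∀ k l → proj₁ (χ (splitAt a k)) ≡ proj₁ (χ (splitAt a l)) → k ≡ l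
  χ∘splitAt-inj k l eq = begin
    k                            ≡⟨ sym (join-splitAt a b k) ⟩
    join a b (splitAt a k)       ≡⟨ cong (join a b) (χ-inj (splitAt a k) (splitAt a l) eq) ⟩
    join a b (splitAt a l)       ≡⟨ join-splitAt a b l ⟩
    l                            ∎
    where open ≡-Reasoning

  preimage : ∀ s → Σ (Fin (a + b)) λ k → proj₁ (χ (splitAt a k)) ≡ proj₁ (χ s)
  preimage s = join a b s , cong (proj₁ ∘ χ) (splitAt-join a b s)

  χ-surj : ∀ g → P g → Σ (Fin (a + b)) λ k → proj₁ (χ (splitAt a k)) ≡ g
  χ-surj (outer j) p with φ-surj j p
  ... | k , refl = preimage (inj₁ k)
  χ-surj (inner i) p with ψ-surj i p
  ... | k , refl = preimage (inj₂ k)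

vertices : Edge → List V
vertices (e , inner i) = plus e i ∷ minus e i ∷ []
vertices (e , outer j) = orig (lookup (elems e) j) ∷ map (plus e) (allFin (m e)) ++ map (minus e) (allFin (m e))

∈ₑ⇒∈vertices : ∀ {v} f → v ∈ₑ f → v ∈ vertices f
∈ₑ⇒∈vertices (e , inner i) (inj₁ refl) = here refl
∈ₑ⇒∈vertices (e , inner i) (inj₂ refl) = there (here refl)
∈ₑ⇒∈vertices (e , outer j) (inj₁ refl) = here refl
∈ₑ⇒∈vertices (e , outer j) (inj₂ (inj₁ (i , _ , refl))) =
  there (∈-++⁺ˡ (∈-map⁺ (plus e) (∈-allFin i)))
∈ₑ⇒∈vertices (e , outer j) (inj₂ (inj₂ (i , _ , refl))) =
  there (∈-++⁺ʳ (map (plus e) (allFin (m e))) (∈-map⁺ (minus e) (∈-allFin i)))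

plus-edges : ∀ {e i} f → plus e i ∈ₑ f → f ≡ (e , outer (inject₁ i)) ⊎ f ≡ (e , inner i)
plus-edges (_ , inner _) (inj₁ refl) = inj₂ refl
plus-edges {i = i} (_ , outer j) (inj₂ (inj₁ (_ , i≡j , refl))) =
  inj₁ (cong (λ j → (_ , outer j)) (toℕ-injective (trans (sym i≡j) (sym (toℕ-inject₁ i)))))

minus-edges : ∀ {e i} f → minus e i ∈ₑ f → f ≡ (e , inner i) ⊎ f ≡ (e , outer (suc i))
minus-edges (_ , inner _) (inj₂ refl) = inj₁ refl
minus-edges (_ , outer j) (inj₂ (inj₂ (_ , 1+i≡j , refl))) =
  inj₂ (cong (λ j → (_ , outer j)) (toℕ-injective (sym 1+i≡j)))

outer-covers-gadget : ∀ {e v} g → v ∈ₑ (e , g) → Σ (Fin (suc (m e))) λ j → v ∈ₑ (e , outer j)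
outer-covers-gadget (outer j) v∈ = j , v∈
outer-covers-gadget (inner i) (inj₁ refl) = inject₁ i , inj₂ (inj₁ (i , sym (toℕ-inject₁ i) , refl))
outer-covers-gadget (inner i) (inj₂ refl) = suc i , inj₂ (inj₂ (i , refl , refl))

cover-meets : ∀ {C v f₁ f₂} → IsEdgeCover C → (∀ f → v ∈ₑ f → f ≡ f₁ ⊎ f ≡ f₂) → C f₁ ⊎ C f₂
cover-meets {v = v} cover edges-at-v with cover v
... | f , f∈C , v∈f = ⊎.map (λ { refl → f∈C }) (λ { refl → f∈C }) (edges-at-v f v∈f)

cover-NoTwoGaps : ∀ {C} → IsEdgeCover C → ∀ e → NoTwoGaps (λ j → C (e , outer j)) (λ i → C (e , inner i))
cover-NoTwoGaps cover e = record
  { A-or-B = λ _ → cover-meets cover plus-edges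
  ; B-or-A = λ _ → cover-meets cover minus-edges
  }

withOuter : EdgeSet → E* → EdgeSet
withOuter C e f = (Σ (Fin (suc (m e))) λ j → f ≡ (e , outer j)) ⊎ (C f × proj₁ f ≢ e)

inner∉withOuter : ∀ {C e i} → ¬ withOuter C e (e , inner i)
inner∉withOuter (inj₂ (_ , e≢e)) = e≢e refl

withOuter∖C : ∀ {C e f} → (withOuter C e ∖ C) f →
  Σ (Fin (suc (m e))) λ j → f ≡ (e , outer j) × ¬ C (e , outer j)
withOuter∖C (inj₁ (j , refl) , ¬c) = j , refl , ¬c
withOuter∖C (inj₂ (c , _) , ¬c)   = ⊥-elim (¬c c)

withOuter-cover : ∀ {C} e → IsEdgeCover C → IsEdgeCover (withOuter C e)
withOuter-cover e cover v with cover v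
... | (e' , g) , c , v∈ with e' ≟E* e
...   | no e'≢e = (e' , g) , inj₂ (c , e'≢e) , v∈
...   | yes refl with outer-covers-gadget g v∈
...     | j , v∈outer = (e , outer j) , inj₁ (j , refl) , v∈outer

module _ {C : EdgeSet} (sm : IsStronglyMinimal C) where

  private
    cover = proj₁ sm
    minimal = proj₂ sm

  unwitnessed-∉ : ∀ f → (∀ v → proj₁ (cover v) ≢ f) → ¬ C f
  unwitnessed-∉ f unwitnessed f∈C with minimal (λ f' → C f' × f' ≢ f) cover-without-f
    where
    cover-without-f : IsEdgeCover (λ f' → C f' × f' ≢ f)
    cover-without-f v = let (f' , f'∈C , v∈f') = cover v in
      f' , (f'∈C , unwitnessed v) , v∈f'
  ... | φ , _ with φ (f , f∈C , λ { (_ , f≢f) → f≢f refl })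
  ...   | _ , (c , _) , ¬c = ¬c c

  _∈C? : Decidable C
  f ∈C? with any? (λ v → proj₁ (cover v) ≟Edge f) (vertices f)
  ... | yes witnessed with satisfied witnessed
  ...   | v , refl = yes (proj₁ (proj₂ (cover v)))
  f ∈C? | no unwitnessed = no (unwitnessed-∉ f λ v chosen →
    unwitnessed (lose (∈ₑ⇒∈vertices f (subst (v ∈ₑ_) chosen (proj₂ (proj₂ (cover v))))) chosen))

  module _ (e : E*) where

    outer∈C? : Decidable (λ j → C (e , outer j))
    outer∈C? j = (e , outer j) ∈C?

    inner∈C? : Decidable (λ i → C (e , inner i))
    inner∈C? i = (e , inner i) ∈C?

    count-inner≤count-outer∉C : count inner∈C? ≤ count (¬? ∘ outer∈C?)
    count-inner≤count-outer∉C =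
      HasSize-mono (enumerate inner∈C?) (enumerate (¬? ∘ outer∈C?)) inner→outer inner→outer-inj
      where
      φ : Σ Edge (C ∖ withOuter C e) → Σ Edge (withOuter C e ∖ C)
      φ = proj₁ (minimal (withOuter C e) (withOuter-cover e cover))

      φ-inj : ∀ x y → proj₁ (φ x) ≡ proj₁ (φ y) → proj₁ x ≡ proj₁ y
      φ-inj = proj₂ (minimal (withOuter C e) (withOuter-cover e cover))

      removed : Σ (Fin (m e)) (λ i → C (e , inner i)) → Σ Edge (C ∖ withOuter C e)
      removed (i , c) = (e , inner i) , c , inner∉withOuter {C}

      target : (x : Σ (Fin (m e)) (λ i → C (e , inner i))) →
        Σ (Fin (suc (m e))) λ j → proj₁ (φ (removed x)) ≡ (e , outer j) × ¬ C (e , outer j)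
      target x = withOuter∖C {C} (proj₂ (φ (removed x)))

      inner→outer : Σ (Fin (m e)) (λ i → C (e , inner i)) → Σ (Fin (suc (m e))) (λ j → ¬ C (e , outer j))
      inner→outer x = Σ.map id proj₂ (target x)

      inner-index : ∀ {i i'} → (e , inner i) ≡ (e , inner i') → i ≡ i'
      inner-index refl = refl

      inner→outer-inj : ∀ x y → proj₁ (inner→outer x) ≡ proj₁ (inner→outer y) → proj₁ x ≡ proj₁ y
      inner→outer-inj x y same-outer = inner-index (φ-inj (removed x) (removed y) (begin
        proj₁ (φ (removed x))                 ≡⟨ proj₁ (proj₂ (target x)) ⟩
        (e , outer (proj₁ (inner→outer x)))   ≡⟨ cong (λ j → (e , outer j)) same-outer ⟩
        (e , outer (proj₁ (inner→outer y)))   ≡⟨ sym (proj₁ (proj₂ (target y))) ⟩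
        proj₁ (φ (removed y))                 ∎))
        where open ≡-Reasoning

    gadget-count-≤ : count outer∈C? + count inner∈C? ≤ suc (m e)
    gadget-count-≤ = ≤-trans (+-monoʳ-≤ (count outer∈C?) count-inner≤count-outer∉C)
                             (≤-reflexive (count-∁ outer∈C?))

lemma3p3 : (C : EdgeSet) → IsStronglyMinimal C → (e : E*) →
    HasSize (C ∩G e) (suc (m e))
    ⊎ ((g : GEdge e) → ((C ∩G e) g → IsInner g) × (IsInner g → (C ∩G e) g))
lemma3p3 C sm e with m≤n⇒m<n∨m≡n (gadget-count-≤ sm e)
... | inj₂ full = inj₁ (subst (HasSize (C ∩G e)) full
                          (HasSize-gadget (enumerate (outer∈C? sm e)) (enumerate (inner∈C? sm e))))
... | inj₁ (s≤s short) with NoTwoGaps-count-tight (outer∈C? sm e) (inner∈C? sm e) gaps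
                              (≤-antisym short (NoTwoGaps-count-≥ (outer∈C? sm e) (inner∈C? sm e) gaps))
  where gaps = cover-NoTwoGaps (proj₁ sm) e
...   | all-inner , no-outer = inj₂ λ
  { (inner i) → (λ _ → i , refl) , λ _ → all-inner i
  ; (outer j) → ⊥-elim ∘ no-outer j , λ { (_ , ()) }
  }
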